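{- Let $D_1 = C_3$ be the directed triangle and, for $k \geq 2$, let $D_k = \Pi(D_{k-1})$. Then $\{\vec{\chi}(D_k) : k \geq 1\}$ is unbounded, and $\vec{\omega}(D_k) = 2$ for every $k \geq 1$.
   Context: A tournament is an orientation of a complete graph. For a tournament $T$ and a total order $\prec$ of $V(T)$, the backedge graph $T^{\prec}$ is the undirected graph on $V(T)$ in which $a,b$ with $a \prec b$ are adjacent iff $ba \in A(T)$; $\vec{\omega}(T) = \min_{\prec}\omega(T^{\prec})$. The dichromatic number $\vec{\chi}(D)$ is the minimum number of parts in a partition of $V(D)$ into sets inducing acyclic subdigraphs. Construction of $\Pi(T)$ for a tournament $T$ on $n$ vertices: let $m = \binom{2n-1}{n}$ and take $2m+1$ disjoint copies $A_1,\dots,A_m,B,C_1,\dots,C_m$ of $T$. Fix a bijection $\varphi$ from $\{1,\dots,m\}$ to the set of $n$-element subsets of $\{1,\dots,2n-1\}$, and for each $j$ a bijection $\psi_j : V(T) \to \varphi(j)$; a vertex of $A_j$ or of $C_j$ that is the copy of $t \in V(T)$ receives label $\psi_j(t)$. Start from the tournament in which each copy induces $T$ and all arcs go from earlier to later copies in the sequence $A_1,\dots,A_m,B,C_1,\dots,C_m$; then reverse the arc from $a \in V(A_i)$ to $c \in V(C_j)$ exactly when $a$ and $c$ have the same label. -}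

module Defs where

open import Data.Nat using (ℕ; zero; suc; _+_; _*_; _∸_; _≤_; _<_)
open import Data.Nat.Combinatorics using (_C_)
open import Data.Fin using (Fin; zero; suc; toℕ; splitAt; remQuot; inject₁; fromℕ)
import Data.Fin as Fin
open import Data.Fin.Subset using (Subset; ∣_∣; _∈_)
open import Data.Bool using (Bool; true; false; not; if_then_else_)
open import Data.Product using (Σ; _×_; _,_; proj₁; proj₂; ∃)
open import Data.Sum using (_⊎_; inj₁; inj₂)
open import Data.Unit using (⊤; tt)
open import Relation.Nullary using (¬_; does)
open import Relation.Binary.PropositionalEquality using (_≡_; _≢_)
open import Function.Bundles using (_⤖_; Bijection)
open import Function.Definitions using (Injective)

record Digraph : Set where
  field
    size : ℕ
    arc  : Fin size → Fin size → Bool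

open Digraph public

IsTournament : Digraph → Set
IsTournament D =
  (∀ a → arc D a a ≡ false) × (∀ a b → a ≢ b → arc D a b ≡ not (arc D b a))

C3-arc : Fin 3 → Fin 3 → Bool
C3-arc zero (suc zero) = true
C3-arc (suc zero) (suc (suc zero)) = true
C3-arc (suc (suc zero)) zero = true
C3-arc _ _ = false

C3 : Digraph
C3 = record { size = 3 ; arc = C3-arc }

DirectedCycleIn : (D : Digraph) → (Fin (size D) → Set) → Set
DirectedCycleIn D P =
  Σ ℕ λ k → Σ (Fin (suc (suc k)) → Fin (size D)) λ g →
    Injective _≡_ _≡_ g
    × (∀ i → P (g i))
    × (∀ (i : Fin (suc k)) → arc D (g (inject₁ i)) (g (suc i)) ≡ true)
    × (arc D (g (fromℕ (suc k))) (g zero) ≡ true)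

AcyclicColourable : Digraph → ℕ → Set
AcyclicColourable D c =
  Σ (Fin (size D) → Fin c) λ f →
    ∀ (col : Fin c) → ¬ DirectedCycleIn D (λ v → f v ≡ col)

IsDichromaticNumber : Digraph → ℕ → Set
IsDichromaticNumber D c =
  AcyclicColourable D c × (∀ c' → AcyclicColourable D c' → c ≤ c')

-- A total order ≺ on Fin n is given by a bijection σ to positions:
-- a ≺ b iff σ a < σ b.
TotalOrder : ℕ → Set
TotalOrder n = Fin n ⤖ Fin n

_≺[_]_ : ∀ {n} → Fin n → TotalOrder n → Fin n → Set
a ≺[ σ ] b = toℕ (Bijection.to σ a) < toℕ (Bijection.to σ b)

BackAdj : (T : Digraph) → TotalOrder (size T) → Fin (size T) → Fin (size T) → Set
BackAdj T σ a b =
  (a ≺[ σ ] b × arc T b a ≡ true) ⊎ (b ≺[ σ ] a × arc T a b ≡ true)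

HasBackClique : (T : Digraph) → TotalOrder (size T) → ℕ → Set
HasBackClique T σ s =
  Σ (Fin s → Fin (size T)) λ g →
    Injective _≡_ _≡_ g × (∀ i j → i ≢ j → BackAdj T σ (g i) (g j))

IsBackCliqueNumber : (T : Digraph) → TotalOrder (size T) → ℕ → Set
IsBackCliqueNumber T σ w =
  HasBackClique T σ w × (∀ s → HasBackClique T σ s → s ≤ w)

IsBackedgeCliqueNumber : Digraph → ℕ → Set
IsBackedgeCliqueNumber T w =
  (Σ (TotalOrder (size T)) λ σ → IsBackCliqueNumber T σ w)
  × (∀ σ w' → IsBackCliqueNumber T σ w' → w ≤ w')

Pi-m : ℕ → ℕ
Pi-m n = (2 * n ∸ 1) C n

-- n-element subsets of {1,…,2n-1} (represented as Fin (2n-1)).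
NSubset : ℕ → Set
NSubset n = Σ (Subset (2 * n ∸ 1)) λ s → ∣ s ∣ ≡ n

-- The choices made in the construction: the bijection φ and the
-- bijections ψ_j : V(T) → φ(j).
record PiData (T : Digraph) : Set where
  field
    φ : Fin (Pi-m (size T)) ⤖ NSubset (size T)
    ψ : (j : Fin (Pi-m (size T))) →
        Fin (size T) ⤖ Σ (Fin (2 * size T ∸ 1)) (λ x → x ∈ proj₁ (Bijection.to φ j))

-- label of the copy of t in A_j or C_j
label : {T : Digraph} → PiData T → Fin (Pi-m (size T)) → Fin (size T) → Fin (2 * size T ∸ 1)
label d j t = proj₁ (Bijection.to (PiData.ψ d j) t)

-- Copies are indexed by Fin (m + (1 + m)), in the order A_1..A_m, B, C_1..C_m.
data CopyKind (m : ℕ) : Set where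
  isA : Fin m → CopyKind m
  isB : CopyKind m
  isC : Fin m → CopyKind m

kind : ∀ m → Fin (m + suc m) → CopyKind m
kind m i with splitAt m i
... | inj₁ a = isA a
... | inj₂ zero = isB
... | inj₂ (suc c) = isC c

sameLabelAC : {T : Digraph} → PiData T →
  CopyKind (Pi-m (size T)) → Fin (size T) → CopyKind (Pi-m (size T)) → Fin (size T) → Bool
sameLabelAC d (isA a) t (isC c) u = does (label d a t Fin.≟ label d c u)
sameLabelAC d _ _ _ _ = false

Pi : (T : Digraph) → PiData T → Digraph
Pi T d = record { size = (m + suc m) * n ; arc = arcΠ }
  where
  n = size T
  m = Pi-m n
  arcΠ : Fin ((m + suc m) * n) → Fin ((m + suc m) * n) → Bool
  arcΠ x y with remQuot n x | remQuot n y
  ... | i , t | j , u with does (i Fin.≟ j)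
  ...   | true = arc T t u
  ...   | false =
          if does (toℕ i Data.Nat.<? toℕ j)
          then not (sameLabelAC d (kind m i) t (kind m j) u)   -- earlier → later, reversed A→C on equal labels
          else sameLabelAC d (kind m j) u (kind m i) t         -- later → earlier only via reversed arcs

-- The sequence D_1 = C₃, D_k = Π(D_{k-1}), for a given choice of the
-- bijections at every step.  D ch 0 is unused (set to C₃).

Dseq : (ch : (T : Digraph) → PiData T) → ℕ → Digraph
Dseq ch zero = C3
Dseq ch (suc zero) = C3
Dseq ch (suc (suc k)) = Pi (Dseq ch (suc k)) (ch (Dseq ch (suc k)))

-- Both halves follow the sequence by induction, carrying a directed triangle in every D_k
-- (inside the copy B of Π).
--
-- Take an acyclic (c + 1)-colouring of Π(T), let α be the colour of a vertex of B and U
-- the set of labels carried by α-coloured vertices of A-copies.  A label shared by an α-vertex of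
-- A_i and one of C_j closes the α-coloured triangle A_i → B → C_j → A_i, so no α-vertex of a
-- C-copy has its label in U.  One of U and its complement contains n of the 2n - 1 labels, hence
-- the label set φ(j) of some copy; that copy (C_j resp. A_j) has no α-vertex, and the colouring
-- restricted to it is an acyclic c-colouring of T.  So χ⃗(D_k) ≥ k + 1.
--
-- Order Π(T) copy by copy, each copy by an order of T without back triangles.  The
-- only back edges between copies join A_i and C_j at equal labels.  A back triangle meeting three
-- copies would need an odd A/C alternation, and one meeting two copies would have two vertices of
-- one copy matching the same label; labels are injective on a copy.  A directed triangle forces a
-- back edge in every order, so ω⃗(D_k) = 2.

module Submission where

open import Defs
open import Data.Bool using (Bool; true; false; not; if_then_else_)
import Data.Bool.Properties as Bool
open import Data.Empty using (⊥-elim)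
open import Data.Fin as Fin
  using (Fin; zero; suc; toℕ; fromℕ; fromℕ<; inject₁; combine; remQuot; quotRem;
         punchIn; punchOut; finToFun; funToFin; _↑ˡ_; _↑ʳ_; _≟_)
open import Data.Fin.Properties
  using (any?; all?; ¬Fin0; ¬∀⟶∃¬-smallest; toℕ-fromℕ; toℕ-fromℕ<; toℕ-inject; toℕ-injective;
         toℕ-↑ˡ; toℕ-↑ʳ; splitAt-↑ˡ; splitAt-↑ʳ; *↔×; remQuot-combine; toℕ-combine;
         combine-monoˡ-<; combine-injectiveˡ; combine-injectiveʳ; combine-surjective;
         finToFun-funToFin; injective⇒≤; toℕ<n; punchIn-punchOut; <⇒≢; <-cmp)
open import Data.Fin.Subset using (Subset; ∣_∣; _∈_; _∉_; _⊆_; ∁; inside; outside)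
  renaming (⊥ to ∅)
open import Data.Fin.Subset.Properties using (∉⊥; ∣⊥∣≡0; ∣∁p∣≡n∸∣p∣; x∈∁p⇒x∉p)
open import Data.Nat as ℕ using (ℕ; zero; suc; _+_; _*_; _∸_; _≤_; _<_; z≤n; s≤s; _≤?_)
open import Data.Nat.Properties
  using (≤-trans; n≤1+n; ≮⇒≥; ≰⇒>; <-asym; <-trans; ≤∧≢⇒<; <⇒≤; n≮n; +-cancelˡ-<; +-monoʳ-<;
         +-identityʳ; ∸-monoˡ-≤; m+n≤o⇒m≤o∸n; module ≤-Reasoning)
open import Data.Product using (Σ; ∃; ∃₂; _×_; _,_; proj₁; proj₂; uncurry; map₂)
import Data.Product as Product
open import Data.Product.Function.NonDependent.Propositional using (_×-⤖_)
open import Data.Sum using (_⊎_; inj₁; inj₂; swap)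
import Data.Sum as Sum
open import Data.Vec using ([]; _∷_; here; there)
open import Data.Vec.Properties.WithK using ([]=-irrelevant)
open import Function using (_∘_; _∘′_; id)
open import Function.Bundles using (Bijection)
open import Function.Construct.Composition using (_⤖-∘_)
open import Function.Construct.Identity using (⤖-id)
open import Function.Definitions using (Injective)
open import Function.Properties.Inverse using (↔⇒⤖; ↔-sym)
open import Relation.Binary.Definitions using (tri<; tri≈; tri>)
open import Relation.Binary.PropositionalEquality
  using (_≡_; _≢_; _≗_; refl; sym; trans; cong; cong₂; subst; subst₂; module ≡-Reasoning)
open import Relation.Nullary using (¬_; Dec; yes; no; does; contradiction)
open import Relation.Nullary.Decidable
  using (map′; ¬?; _×-dec_; _⊎-dec_; _→-dec_; dec-true; dec-false; decidable-stable; from-yes)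
open import Relation.Unary using (Decidable)

-- Acyclic colourings and the dichromatic number

cycle-mono : ∀ {D} {P Q : Fin (size D) → Set} → (∀ {v} → P v → Q v) →
             DirectedCycleIn D P → DirectedCycleIn D Q
cycle-mono P⇒Q (k , g , g-inj , P∘g , path , closing) = k , g , g-inj , P⇒Q ∘ P∘g , path , closing

record Triangle (D : Digraph) : Set where
  field
    x y z : Fin (size D)
    x≢y : x ≢ y
    y≢z : y ≢ z
    x≢z : x ≢ z
    x⇒y : arc D x y ≡ true
    y⇒z : arc D y z ≡ true
    z⇒x : arc D z x ≡ true

triangle⇒cycle : ∀ {D} {P : Fin (size D) → Set} (tr : Triangle D) → let open Triangle tr in
                 P x → P y → P z → DirectedCycleIn D P
triangle⇒cycle {D} {P} tr Px Py Pz = 1 , g , g-inj , P∘g , path , z⇒x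
  where
  open Triangle tr
  g : Fin 3 → Fin (size D)
  g zero = x
  g (suc zero) = y
  g (suc (suc zero)) = z
  g-inj : Injective _≡_ _≡_ g
  g-inj {zero} {zero} _ = refl
  g-inj {zero} {suc zero} x≡y = contradiction x≡y x≢y
  g-inj {zero} {suc (suc zero)} x≡z = contradiction x≡z x≢z
  g-inj {suc zero} {zero} y≡x = contradiction (sym y≡x) x≢y
  g-inj {suc zero} {suc zero} _ = refl
  g-inj {suc zero} {suc (suc zero)} y≡z = contradiction y≡z y≢z
  g-inj {suc (suc zero)} {zero} z≡x = contradiction (sym z≡x) x≢z
  g-inj {suc (suc zero)} {suc zero} z≡y = contradiction (sym z≡y) y≢z
  g-inj {suc (suc zero)} {suc (suc zero)} _ = refl
  P∘g : ∀ i → P (g i)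
  P∘g zero = Px
  P∘g (suc zero) = Py
  P∘g (suc (suc zero)) = Pz
  path : ∀ (i : Fin 2) → arc D (g (inject₁ i)) (g (suc i)) ≡ true
  path zero = x⇒y
  path (suc zero) = y⇒z

triangle⇒2≤colours : ∀ {D c} → Triangle D → AcyclicColourable D c → 2 ≤ c
triangle⇒2≤colours {c = zero} tr (f , _) = contradiction (f (Triangle.x tr)) ¬Fin0
triangle⇒2≤colours {c = suc zero} tr (f , acyclic) =
  contradiction (triangle⇒cycle {P = λ v → f v ≡ zero} tr (only _) (only _) (only _)) (acyclic zero)
  where
  only : (col : Fin 1) → col ≡ zero
  only zero = refl
triangle⇒2≤colours {c = suc (suc c)} _ _ = s≤s (s≤s z≤n)

identityColouring : ∀ D → AcyclicColourable D (size D)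
identityColouring D = id , λ col (_ , g , g-inj , g≡col , _) →
  contradiction (g-inj (trans (g≡col zero) (sym (g≡col (suc zero))))) λ ()

∃-function? : ∀ {n m} {Q : (Fin n → Fin m) → Set} → (∀ {f g} → f ≗ g → Q f → Q g) →
              (∀ f → Dec (Q f)) → Dec (∃ Q)
∃-function? Q-respects Q? =
  map′ (λ (k , Qk) → finToFun k , Qk)
       (λ (f , Qf) → funToFin f , Q-respects (sym ∘ finToFun-funToFin f) Qf)
       (any? (Q? ∘ finToFun))

IsDirectedCycle : (D : Digraph) → (Fin (size D) → Set) → (k : ℕ) →
                  (Fin (suc (suc k)) → Fin (size D)) → Set
IsDirectedCycle D P k g =
  Injective _≡_ _≡_ g
  × (∀ i → P (g i))
  × (∀ (i : Fin (suc k)) → arc D (g (inject₁ i)) (g (suc i)) ≡ true)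
  × (arc D (g (fromℕ (suc k))) (g zero) ≡ true)

injective? : ∀ {a b} (g : Fin a → Fin b) → Dec (Injective _≡_ _≡_ g)
injective? g = map′ (λ inj {x} {y} → inj x y) (λ inj x y → inj {x} {y})
                    (all? λ x → all? λ y → (g x ≟ g y) →-dec (x ≟ y))

directedCycle? : ∀ D {P : Fin (size D) → Set} → Decidable P → Dec (DirectedCycleIn D P)
directedCycle? D {P} P? =
  map′ (λ (k , cyc) → toℕ k , cyc) bounded
       (any? λ k → ∃-function? (respects (toℕ k)) (isCycle? (toℕ k)))
  where
  isCycle? : ∀ k g → Dec (IsDirectedCycle D P k g)
  isCycle? k g = injective? g ×-dec all? (P? ∘ g)
    ×-dec all? (λ i → arc D (g (inject₁ i)) (g (suc i)) Bool.≟ true)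
    ×-dec (arc D (g (fromℕ (suc k))) (g zero) Bool.≟ true)
  respects : ∀ k {f g} → f ≗ g → IsDirectedCycle D P k f → IsDirectedCycle D P k g
  respects k f≗g (f-inj , P∘f , path , closing) =
    (λ {x} {y} gx≡gy → f-inj (trans (f≗g x) (trans gx≡gy (sym (f≗g y))))) ,
    (λ i → subst P (f≗g i) (P∘f i)) ,
    (λ i → subst₂ (λ a b → arc D a b ≡ true) (f≗g (inject₁ i)) (f≗g (suc i)) (path i)) ,
    subst₂ (λ a b → arc D a b ≡ true) (f≗g (fromℕ (suc k))) (f≗g zero) closing
  bounded : DirectedCycleIn D P → ∃ λ (k : Fin (size D)) → Σ _ (IsDirectedCycle D P (toℕ k))
  bounded (k , g , cyc) = fromℕ< k<size ,
    subst (λ k → Σ _ (IsDirectedCycle D P k)) (sym (toℕ-fromℕ< k<size)) (g , cyc)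
    where
    k<size : k < size D
    k<size = ≤-trans (n≤1+n (suc k)) (injective⇒≤ (proj₁ cyc))

acyclicColourable? : ∀ D c → Dec (AcyclicColourable D c)
acyclicColourable? D c =
  ∃-function? respects λ f → all? λ col → ¬? (directedCycle? D λ v → f v ≟ col)
  where
  respects : ∀ {f g : Fin (size D) → Fin c} → f ≗ g →
             (∀ col → ¬ DirectedCycleIn D λ v → f v ≡ col) →
             ∀ col → ¬ DirectedCycleIn D λ v → g v ≡ col
  respects f≗g acyclic col cyc = acyclic col (cycle-mono {D} (λ {v} → trans (f≗g v)) cyc)

least-witness : ∀ {P : ℕ → Set} → Decidable P → ∀ {n} → P n →
                Σ ℕ λ c → P c × (∀ c′ → P c′ → c ≤ c′)
least-witness {P} P? {n} Pn
  with i , ¬¬Pi , below ← ¬∀⟶∃¬-smallest (suc n) (¬_ ∘ P ∘ toℕ) (¬? ∘ P? ∘ toℕ)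
                            (λ ¬P → ¬P (fromℕ n) (subst P (sym (toℕ-fromℕ n)) Pn))
  = toℕ i , decidable-stable (P? _) ¬¬Pi , λ c′ Pc′ → ≮⇒≥ λ c′<i →
      below (fromℕ< c′<i) (subst P (sym (trans (toℕ-inject _) (toℕ-fromℕ< c′<i))) Pc′)

dichromaticNumber : ∀ D → Σ ℕ (IsDichromaticNumber D)
dichromaticNumber D = least-witness (acyclicColourable? D) (identityColouring D)

record Embedding (T D : Digraph) : Set where
  field
    embed : Fin (size T) → Fin (size D)
    embed-injective : Injective _≡_ _≡_ embed
    embed-arc : ∀ t u → arc D (embed t) (embed u) ≡ arc T t u

triangle-embed : ∀ {T D} → Embedding T D → Triangle T → Triangle D
triangle-embed e tr = record
  { x = embed x ; y = embed y ; z = embed z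
  ; x≢y = x≢y ∘ embed-injective ; y≢z = y≢z ∘ embed-injective ; x≢z = x≢z ∘ embed-injective
  ; x⇒y = trans (embed-arc x y) x⇒y
  ; y⇒z = trans (embed-arc y z) y⇒z
  ; z⇒x = trans (embed-arc z x) z⇒x
  }
  where
  open Embedding e
  open Triangle tr

colouring-avoiding⇒colouring : ∀ {T D c} (e : Embedding T D) (f : Fin (size D) → Fin (suc c)) →
  (∀ col → ¬ DirectedCycleIn D (λ v → f v ≡ col)) →
  ∀ α → (∀ t → f (Embedding.embed e t) ≢ α) → AcyclicColourable T c
colouring-avoiding⇒colouring {T} {c = c} e f acyclic α avoids = f′ , acyclic′
  where
  open Embedding e
  f′ : Fin (size T) → Fin c
  f′ t = punchOut (avoids t ∘ sym)
  acyclic′ : ∀ col → ¬ DirectedCycleIn T (λ t → f′ t ≡ col)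
  acyclic′ col (k , g , g-inj , f′∘g≡col , path , closing) = acyclic (punchIn α col)
    ( k , embed ∘ g , g-inj ∘ embed-injective
    , (λ i → trans (sym (punchIn-punchOut _)) (cong (punchIn α) (f′∘g≡col i)))
    , (λ i → trans (embed-arc _ _) (path i)) , trans (embed-arc _ _) closing )

-- Backedge cliques

BackTriangleFree : (T : Digraph) → TotalOrder (size T) → Set
BackTriangleFree T σ = ∀ x y z → BackAdj T σ x y → BackAdj T σ y z → ¬ BackAdj T σ x z

module _ {T : Digraph} {σ : TotalOrder (size T)} where

  backAdj⇒≢ : ∀ {a b} → BackAdj T σ a b → a ≢ b
  backAdj⇒≢ (inj₁ (a≺b , _)) refl = n≮n _ a≺b
  backAdj⇒≢ (inj₂ (b≺a , _)) refl = n≮n _ b≺a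

  backClique : ∀ {s} (g : Fin s → Fin (size T)) → (∀ i j → i ≢ j → BackAdj T σ (g i) (g j)) →
               HasBackClique T σ s
  backClique g adjacent = g , g-inj , adjacent
    where
    g-inj : Injective _≡_ _≡_ g
    g-inj {i} {j} gi≡gj with i ≟ j
    ... | yes i≡j = i≡j
    ... | no i≢j = contradiction gi≡gj (backAdj⇒≢ (adjacent i j i≢j))

  edge⇒backClique : ∀ {a b} → BackAdj T σ a b → HasBackClique T σ 2
  edge⇒backClique {a} {b} ab = backClique ends adjacent
    where
    ends : Fin 2 → Fin (size T)
    ends zero = a
    ends (suc zero) = b
    adjacent : ∀ i j → i ≢ j → BackAdj T σ (ends i) (ends j)
    adjacent zero zero 0≢0 = contradiction refl 0≢0
    adjacent zero (suc zero) _ = ab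
    adjacent (suc zero) zero _ = swap ab
    adjacent (suc zero) (suc zero) 1≢1 = contradiction refl 1≢1

  backClique≤2 : BackTriangleFree T σ → ∀ {s} → HasBackClique T σ s → s ≤ 2
  backClique≤2 _ {zero} _ = z≤n
  backClique≤2 _ {suc zero} _ = s≤s z≤n
  backClique≤2 _ {suc (suc zero)} _ = s≤s (s≤s z≤n)
  backClique≤2 free {suc (suc (suc s))} (g , _ , adjacent) = ⊥-elim
    (free (g zero) (g (suc zero)) (g (suc (suc zero)))
          (adjacent _ _ λ ()) (adjacent _ _ λ ()) (adjacent _ _ λ ()))

  triangle⇒backEdge : Triangle T → ∃₂ (BackAdj T σ)
  triangle⇒backEdge tr = backEdge (_ ℕ.<? _) (_ ℕ.<? _)
    where
    open Triangle tr
    backEdge : Dec (y ≺[ σ ] x) → Dec (z ≺[ σ ] y) → ∃₂ (BackAdj T σ)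
    backEdge (yes y≺x) _ = x , y , inj₂ (y≺x , x⇒y)
    backEdge (no _) (yes z≺y) = y , z , inj₂ (z≺y , y⇒z)
    backEdge (no y⊀x) (no z⊀y) = x , z , inj₁ (x≺z , z⇒x)
      where
      x≺z : x ≺[ σ ] z
      x≺z = ≤∧≢⇒< (≤-trans (≮⇒≥ y⊀x) (≮⇒≥ z⊀y)) (x≢z ∘ Bijection.injective σ ∘ toℕ-injective)

backedgeCliqueNumber≡2 : ∀ {T} → Triangle T → Σ _ (BackTriangleFree T) →
                         IsBackedgeCliqueNumber T 2
backedgeCliqueNumber≡2 {T} tr (σ , free) =
  (σ , backEdgeClique σ , λ _ → backClique≤2 {T} {σ} free) ,
  λ σ′ _ (_ , maximal) → maximal 2 (backEdgeClique σ′)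
  where
  backEdgeClique : ∀ σ → HasBackClique T σ 2
  backEdgeClique σ = edge⇒backClique {T} {σ} (proj₂ (proj₂ (triangle⇒backEdge {T} {σ} tr)))

-- Lexicographic orders and subsets of labels

lexOrder : ∀ {M n} → TotalOrder n → TotalOrder (M * n)
lexOrder {M} σ = ↔⇒⤖ (↔-sym (*↔× {M})) ⤖-∘ ((⤖-id _ ×-⤖ σ) ⤖-∘ ↔⇒⤖ (*↔× {M}))

lexOrder-combine : ∀ {M n} (σ : TotalOrder n) (i : Fin M) t →
                   Bijection.to (lexOrder {M} σ) (combine i t) ≡ combine i (Bijection.to σ t)
lexOrder-combine σ i t = cong (uncurry combine ∘′ map₂ (Bijection.to σ)) (remQuot-combine i t)

combine-<-lex : ∀ {M n} {i j : Fin M} {a b : Fin n} →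
                combine i a Fin.< combine j b → i Fin.< j ⊎ (i ≡ j × a Fin.< b)
combine-<-lex {n = n} {i} {j} {a} {b} ia<jb with <-cmp i j
... | tri< i<j _ _ = inj₁ i<j
... | tri> _ _ j<i = contradiction ia<jb (<-asym (combine-monoˡ-< b a j<i))
... | tri≈ _ refl _ = inj₂ (refl , +-cancelˡ-< (n * toℕ i) (toℕ a) (toℕ b)
                                     (subst₂ _<_ (toℕ-combine i a) (toℕ-combine i b) ia<jb))

≺-lexOrder : ∀ {M n} {σ : TotalOrder n} {i j : Fin M} {t u} →
             combine i t ≺[ lexOrder {M} σ ] combine j u → i Fin.< j ⊎ (i ≡ j × t ≺[ σ ] u)
≺-lexOrder {σ = σ} {i} {j} {t} {u} =
  combine-<-lex ∘ subst₂ Fin._<_ (lexOrder-combine σ i t) (lexOrder-combine σ j u)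

subsetOf : ∀ {n} {P : Fin n → Set} → Decidable P → Subset n
subsetOf {zero} _ = []
subsetOf {suc n} P? = does (P? zero) ∷ subsetOf (P? ∘ suc)

∈-subsetOf⁺ : ∀ {n} {P : Fin n → Set} (P? : Decidable P) {x} → P x → x ∈ subsetOf P?
∈-subsetOf⁺ P? {zero} P0 with P? zero
... | yes _ = here
... | no ¬P0 = contradiction P0 ¬P0
∈-subsetOf⁺ P? {suc x} Px = there (∈-subsetOf⁺ (P? ∘ suc) Px)

∈-subsetOf⁻ : ∀ {n} {P : Fin n → Set} (P? : Decidable P) {x} → x ∈ subsetOf P? → P x
∈-subsetOf⁻ P? {zero} 0∈ with P? zero
... | yes P0 = P0
∈-subsetOf⁻ P? {zero} () | no _
∈-subsetOf⁻ P? {suc x} (there x∈) = ∈-subsetOf⁻ (P? ∘ suc) x∈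

subset-of-size : ∀ {K r} (p : Subset K) → r ≤ ∣ p ∣ → ∃ λ q → ∣ q ∣ ≡ r × q ⊆ p
subset-of-size {K} {zero} p _ = ∅ , ∣⊥∣≡0 K , λ x∈∅ → contradiction x∈∅ ∉⊥
subset-of-size {r = suc r} (inside ∷ p) (s≤s r≤∣p∣)
  with q , ∣q∣≡r , q⊆p ← subset-of-size p r≤∣p∣ =
  inside ∷ q , cong suc ∣q∣≡r , λ { here → here ; (there x∈q) → there (q⊆p x∈q) }
subset-of-size {r = suc r} (outside ∷ p) r≤∣p∣
  with q , ∣q∣≡r , q⊆p ← subset-of-size p r≤∣p∣ =
  outside ∷ q , ∣q∣≡r , λ { (there x∈q) → there (q⊆p x∈q) }

large-side : ∀ n (p : Subset (2 * n ∸ 1)) → n ≤ ∣ p ∣ ⊎ n ≤ ∣ ∁ p ∣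
large-side n p with n ≤? ∣ p ∣
... | yes n≤∣p∣ = inj₁ n≤∣p∣
... | no n≰∣p∣ = inj₂ (begin
  n                       ≤⟨ m+n≤o⇒m≤o∸n n n+∣p∣≤2n∸1 ⟩
  2 * n ∸ 1 ∸ ∣ p ∣       ≡⟨ sym (∣∁p∣≡n∸∣p∣ p) ⟩
  ∣ ∁ p ∣                 ∎)
  where
  open ≤-Reasoning
  n+∣p∣≤2n∸1 : n + ∣ p ∣ ≤ 2 * n ∸ 1
  n+∣p∣≤2n∸1 = begin
    n + ∣ p ∣             ≤⟨ ∸-monoˡ-≤ 1 (+-monoʳ-< n (≰⇒> n≰∣p∣)) ⟩
    n + n ∸ 1             ≡⟨ cong (λ k → n + k ∸ 1) (sym (+-identityʳ n)) ⟩
    2 * n ∸ 1             ∎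

-- The construction Π(T)

module Π (T : Digraph) (d : PiData T) where

  private
    n = size T
    m = Pi-m n

  Copy : Set
  Copy = Fin (m + suc m)

  copyArc : Copy × Fin n → Copy × Fin n → Bool
  copyArc (i , t) (j , u) =
    if does (i ≟ j) then arc T t u
    else if does (toℕ i ℕ.<? toℕ j) then not (sameLabelAC d (kind m i) t (kind m j) u)
    else sameLabelAC d (kind m j) u (kind m i) t

  arc-combine : ∀ i t j u → arc (Pi T d) (combine i t) (combine j u) ≡ copyArc (i , t) (j , u)
  arc-combine i t j u =
    trans (arc-remQuot _ _) (cong₂ copyArc (remQuot-combine i t) (remQuot-combine j u))
    where
    arc-remQuot : ∀ x y → arc (Pi T d) x y ≡ copyArc (remQuot n x) (remQuot n y)
    arc-remQuot x y with quotRem {m + suc m} n x | quotRem {m + suc m} n y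
    ... | t , i | u , j with does (i ≟ j)
    ... | true = refl
    ... | false = refl

  arc-within : ∀ i t u → arc (Pi T d) (combine i t) (combine i u) ≡ arc T t u
  arc-within i t u rewrite arc-combine i t i u | dec-true (i ≟ i) refl = refl

  arc-forward : ∀ {i j} → i Fin.< j → ∀ t u →
                arc (Pi T d) (combine i t) (combine j u) ≡
                not (sameLabelAC d (kind m i) t (kind m j) u)
  arc-forward {i} {j} i<j t u
    rewrite arc-combine i t j u | dec-false (i ≟ j) (<⇒≢ i<j)
          | dec-true (toℕ i ℕ.<? toℕ j) i<j
    = refl

  arc-backward : ∀ {i j} → i Fin.< j → ∀ t u →
                 arc (Pi T d) (combine j u) (combine i t) ≡
                 sameLabelAC d (kind m i) t (kind m j) u
  arc-backward {i} {j} i<j t u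
    rewrite arc-combine j u i t | dec-false (j ≟ i) (<⇒≢ i<j ∘ sym)
          | dec-false (toℕ j ℕ.<? toℕ i) (<-asym i<j)
    = refl

  copy : Copy → Embedding T (Pi T d)
  copy i = record
    { embed = combine i
    ; embed-injective = λ {t} {u} → combine-injectiveʳ i t i u
    ; embed-arc = arc-within i
    }

  A : Fin m → Copy
  A a = a ↑ˡ suc m

  B : Copy
  B = m ↑ʳ zero

  C : Fin m → Copy
  C c = m ↑ʳ suc c

  kind-A : ∀ a → kind m (A a) ≡ isA a
  kind-A a rewrite splitAt-↑ˡ m a (suc m) = refl

  kind-B : kind m B ≡ isB
  kind-B rewrite splitAt-↑ʳ m (suc m) zero = refl

  kind-C : ∀ c → kind m (C c) ≡ isC c
  kind-C c rewrite splitAt-↑ʳ m (suc m) (suc c) = refl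

  A<B : ∀ a → A a Fin.< B
  A<B a = begin-strict
    toℕ (A a)   ≡⟨ toℕ-↑ˡ a (suc m) ⟩
    toℕ a       <⟨ toℕ<n a ⟩
    m           ≡⟨ sym (+-identityʳ m) ⟩
    m + 0       ≡⟨ sym (toℕ-↑ʳ m zero) ⟩
    toℕ B       ∎
    where open ≤-Reasoning

  B<C : ∀ c → B Fin.< C c
  B<C c = subst₂ _<_ (sym (toℕ-↑ʳ m zero)) (sym (toℕ-↑ʳ m (suc c))) (+-monoʳ-< m (s≤s z≤n))

  A<C : ∀ a c → A a Fin.< C c
  A<C a c = <-trans (A<B a) (B<C c)

  A-B-C-triangle : ∀ {a c t u} (t₀ : Fin n) → label d a t ≡ label d c u → Triangle (Pi T d)
  A-B-C-triangle {a} {c} {t} {u} t₀ ℓt≡ℓu = record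
    { x = combine (A a) t ; y = combine B t₀ ; z = combine (C c) u
    ; x≢y = combine-≢ (A<B a) ; y≢z = combine-≢ (B<C c) ; x≢z = combine-≢ (A<C a c)
    ; x⇒y = A⇒B ; y⇒z = B⇒C ; z⇒x = C⇒A
    }
    where
    combine-≢ : ∀ {i j : Copy} {t u} → i Fin.< j → combine i t ≢ combine j u
    combine-≢ {i} {j} {t} {u} i<j = <⇒≢ i<j ∘ combine-injectiveˡ i t j u
    A⇒B : arc (Pi T d) (combine (A a) t) (combine B t₀) ≡ true
    A⇒B = trans (arc-forward (A<B a) t t₀)
                (cong₂ (λ k k′ → not (sameLabelAC d k t k′ t₀)) (kind-A a) kind-B)
    B⇒C : arc (Pi T d) (combine B t₀) (combine (C c) u) ≡ true
    B⇒C = trans (arc-forward (B<C c) t₀ u)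
                (cong₂ (λ k k′ → not (sameLabelAC d k t₀ k′ u)) kind-B (kind-C c))
    C⇒A : arc (Pi T d) (combine (C c) u) (combine (A a) t) ≡ true
    C⇒A = begin
      arc (Pi T d) (combine (C c) u) (combine (A a) t)
        ≡⟨ arc-backward (A<C a c) t u ⟩
      sameLabelAC d (kind m (A a)) t (kind m (C c)) u
        ≡⟨ cong₂ (λ k k′ → sameLabelAC d k t k′ u) (kind-A a) (kind-C c) ⟩
      does (label d a t ≟ label d c u)
        ≡⟨ dec-true (label d a t ≟ label d c u) ℓt≡ℓu ⟩
      true
        ∎
      where open ≡-Reasoning

  label-injective : ∀ j {t u} → label d j t ≡ label d j u → t ≡ u
  label-injective j ℓt≡ℓu = Bijection.injective (PiData.ψ d j) (label≡⇒≡ ℓt≡ℓu)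
    where
    label≡⇒≡ : ∀ {x y : Σ _ (_∈ proj₁ (Bijection.to (PiData.φ d) j))} → proj₁ x ≡ proj₁ y → x ≡ y
    label≡⇒≡ {ℓ , p} {.ℓ , q} refl = cong (ℓ ,_) ([]=-irrelevant p q)

  labels-within : ∀ {p} → n ≤ ∣ p ∣ → ∃ λ j → ∀ t → label d j t ∈ p
  labels-within {p} n≤∣p∣ =
    let q , ∣q∣≡n , q⊆p = subset-of-size p n≤∣p∣
        j , φj≡q = Bijection.surjective (PiData.φ d) (q , ∣q∣≡n)
        label∈φj t = proj₂ (Bijection.to (PiData.ψ d j) t)
    in j , λ t → q⊆p (subst (λ s → label d j t ∈ proj₁ s) (φj≡q refl) (label∈φj t))

  colouring⇒colouring : Fin n → ∀ {c} → AcyclicColourable (Pi T d) (suc c) → AcyclicColourable T c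
  colouring⇒colouring t₀ {c} (f , acyclic) = Sum.[ fromC , fromA ]′ (large-side n U)
    where
    α = f (combine B t₀)
    LabelOfαInA : Fin (2 * n ∸ 1) → Set
    LabelOfαInA ℓ = ∃₂ λ a t → label d a t ≡ ℓ × f (combine (A a) t) ≡ α
    labelOfαInA? : Decidable LabelOfαInA
    labelOfαInA? ℓ = any? λ a → any? λ t → (label d a t ≟ ℓ) ×-dec (f (combine (A a) t) ≟ α)
    U : Subset (2 * n ∸ 1)
    U = subsetOf labelOfαInA?
    A-avoids : ∀ {a t} → label d a t ∉ U → f (combine (A a) t) ≢ α
    A-avoids {a} {t} ℓ∉U fx≡α = ℓ∉U (∈-subsetOf⁺ labelOfαInA? (a , t , refl , fx≡α))
    C-avoids : ∀ {j u} → label d j u ∈ U → f (combine (C j) u) ≢ α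
    C-avoids ℓ∈U fz≡α with a , t , ℓt≡ℓu , fx≡α ← ∈-subsetOf⁻ labelOfαInA? ℓ∈U =
      acyclic α (triangle⇒cycle {P = λ v → f v ≡ α} (A-B-C-triangle t₀ ℓt≡ℓu) fx≡α refl fz≡α)
    avoid : (I : Copy) → (∀ t → f (combine I t) ≢ α) → AcyclicColourable T c
    avoid I = colouring-avoiding⇒colouring (copy I) f acyclic α
    fromC : n ≤ ∣ U ∣ → AcyclicColourable T c
    fromC n≤∣U∣ = let j , ℓ∈U = labels-within n≤∣U∣ in avoid (C j) (C-avoids ∘ ℓ∈U)
    fromA : n ≤ ∣ ∁ U ∣ → AcyclicColourable T c
    fromA n≤∣∁U∣ = let j , ℓ∈∁U = labels-within n≤∣∁U∣ in avoid (A j) (A-avoids ∘ x∈∁p⇒x∉p ∘ ℓ∈∁U)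

  data LabelMatch : CopyKind m → Fin n → CopyKind m → Fin n → Set where
    A-C : ∀ {a c t u} → label d a t ≡ label d c u → LabelMatch (isA a) t (isC c) u
    C-A : ∀ {a c t u} → label d a t ≡ label d c u → LabelMatch (isC c) u (isA a) t

  LabelMatch-sym : ∀ {k t k′ u} → LabelMatch k t k′ u → LabelMatch k′ u k t
  LabelMatch-sym (A-C e) = C-A e
  LabelMatch-sym (C-A e) = A-C e

  LabelMatch-functional : ∀ {k t t′ k′ u} → LabelMatch k t k′ u → LabelMatch k t′ k′ u → t ≡ t′
  LabelMatch-functional {isA a} (A-C e) (A-C e′) = label-injective a (trans e (sym e′))
  LabelMatch-functional {isC c} (C-A e) (C-A e′) = label-injective c (trans (sym e) e′)

  LabelMatch-no-triangle : ∀ {k₁ t₁ k₂ t₂ k₃ t₃} →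
    LabelMatch k₁ t₁ k₂ t₂ → LabelMatch k₂ t₂ k₃ t₃ → ¬ LabelMatch k₁ t₁ k₃ t₃
  LabelMatch-no-triangle (A-C _) (C-A _) ()
  LabelMatch-no-triangle (C-A _) (A-C _) ()

  sameLabel⇒LabelMatch : ∀ k t k′ u → sameLabelAC d k t k′ u ≡ true → LabelMatch k t k′ u
  sameLabel⇒LabelMatch (isA a) t (isC c) u same with label d a t ≟ label d c u
  ... | yes e = A-C e
  sameLabel⇒LabelMatch (isA a) t (isC c) u () | no _
  sameLabel⇒LabelMatch (isA _) _ (isA _) _ ()
  sameLabel⇒LabelMatch (isA _) _ isB _ ()
  sameLabel⇒LabelMatch isB _ _ _ ()
  sameLabel⇒LabelMatch (isC _) _ _ _ ()

  order : TotalOrder n → TotalOrder (size (Pi T d))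
  order = lexOrder {m + suc m}

  module _ (σ : TotalOrder n) where

    backAdj-within : ∀ {i t u} → BackAdj (Pi T d) (order σ) (combine i t) (combine i u) →
                     BackAdj T σ t u
    backAdj-within {i} = Sum.map (Product.map ≺-within (trans (sym (arc-within i _ _))))
                                 (Product.map ≺-within (trans (sym (arc-within i _ _))))
      where
      ≺-within : ∀ {t u} → combine i t ≺[ order σ ] combine i u → t ≺[ σ ] u
      ≺-within ≺ with ≺-lexOrder {m + suc m} {σ = σ} ≺
      ... | inj₁ i<i = contradiction i<i (n≮n _)
      ... | inj₂ (_ , t≺u) = t≺u

    backArc-across : ∀ {i j t u} → i ≢ j → combine i t ≺[ order σ ] combine j u →
                     arc (Pi T d) (combine j u) (combine i t) ≡ true →
                     LabelMatch (kind m i) t (kind m j) u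
    backArc-across {i} {j} {t} {u} i≢j ≺ arc with ≺-lexOrder {m + suc m} {σ = σ} ≺
    ... | inj₁ i<j = sameLabel⇒LabelMatch _ t _ u (trans (sym (arc-backward i<j t u)) arc)
    ... | inj₂ (i≡j , _) = contradiction i≡j i≢j

    backAdj-across : ∀ {i j t u} → i ≢ j → BackAdj (Pi T d) (order σ) (combine i t) (combine j u) →
                     LabelMatch (kind m i) t (kind m j) u
    backAdj-across i≢j (inj₁ (≺ , arc)) = backArc-across i≢j ≺ arc
    backAdj-across i≢j (inj₂ (≺ , arc)) = LabelMatch-sym (backArc-across (i≢j ∘ sym) ≺ arc)

    no-common-match : ∀ {i t u k w} → BackAdj (Pi T d) (order σ) (combine i t) (combine i u) →
                      LabelMatch (kind m i) t k w → ¬ LabelMatch (kind m i) u k w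
    no-common-match {i} tu tw uw =
      backAdj⇒≢ {Pi T d} {order σ} tu (cong (combine i) (LabelMatch-functional tw uw))

    backTriangleFree : BackTriangleFree T σ → BackTriangleFree (Pi T d) (order σ)
    backTriangleFree free x y z xy yz xz
      with combine-surjective {m + suc m} {n} x | combine-surjective {m + suc m} {n} y
         | combine-surjective {m + suc m} {n} z
    ... | i , t , refl | j , u , refl | k , v , refl with i ≟ j | j ≟ k | i ≟ k
    ...   | yes refl | yes refl | _ =
      free t u v (backAdj-within xy) (backAdj-within yz) (backAdj-within xz)
    ...   | yes refl | no j≢k | _ =
      no-common-match xy (backAdj-across j≢k xz) (backAdj-across j≢k yz)
    ...   | no i≢j | yes refl | _ =
      no-common-match yz (LabelMatch-sym (backAdj-across i≢j xy))
                         (LabelMatch-sym (backAdj-across i≢j xz))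
    ...   | no i≢j | no j≢k | yes refl =
      no-common-match xz (backAdj-across i≢j xy) (LabelMatch-sym (backAdj-across j≢k yz))
    ...   | no i≢j | no j≢k | no i≢k =
      LabelMatch-no-triangle (backAdj-across i≢j xy) (backAdj-across j≢k yz) (backAdj-across i≢k xz)

-- The sequence D_k

C3-triangle : Triangle C3
C3-triangle = record
  { x = zero ; y = suc zero ; z = suc (suc zero)
  ; x≢y = λ () ; y≢z = λ () ; x≢z = λ ()
  ; x⇒y = refl ; y⇒z = refl ; z⇒x = refl
  }

backAdj? : ∀ T σ x y → Dec (BackAdj T σ x y)
backAdj? T σ x y =
  ((_ ℕ.<? _) ×-dec (arc T y x Bool.≟ true)) ⊎-dec ((_ ℕ.<? _) ×-dec (arc T x y Bool.≟ true))

C3-backTriangleFree : BackTriangleFree C3 (⤖-id _)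
C3-backTriangleFree = from-yes (all? λ x → all? λ y → all? λ z →
  backAdj? C3 σ x y →-dec backAdj? C3 σ y z →-dec ¬? (backAdj? C3 σ x z))
  where
  σ = ⤖-id _

module _ (ch : (T : Digraph) → PiData T) where

  Dseq-triangle : ∀ k → Triangle (Dseq ch (suc k))
  Dseq-triangle zero = C3-triangle
  Dseq-triangle (suc k) = triangle-embed (Π.copy D (ch D) (Π.B D (ch D))) (Dseq-triangle k)
    where D = Dseq ch (suc k)

  Dseq-backTriangleFree : ∀ k → Σ _ (BackTriangleFree (Dseq ch (suc k)))
  Dseq-backTriangleFree zero = ⤖-id _ , C3-backTriangleFree
  Dseq-backTriangleFree (suc k) =
    let σ , free = Dseq-backTriangleFree k in Π.order D (ch D) σ , Π.backTriangleFree D (ch D) σ free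
    where D = Dseq ch (suc k)

  Dseq-needs-colours : ∀ k {c} → AcyclicColourable (Dseq ch (suc k)) c → suc k < c
  Dseq-needs-colours zero = triangle⇒2≤colours C3-triangle
  Dseq-needs-colours (suc k) {zero} (f , _) =
    contradiction (f (Triangle.x (Dseq-triangle (suc k)))) ¬Fin0
  Dseq-needs-colours (suc k) {suc c} colouring =
    s≤s (Dseq-needs-colours k
          (Π.colouring⇒colouring D (ch D) (Triangle.x (Dseq-triangle k)) colouring))
    where D = Dseq ch (suc k)

corollary4p6 : (ch : (T : Digraph) → PiData T) →
    ((c : ℕ) → Σ ℕ λ k → 1 ≤ k × Σ ℕ λ χ → IsDichromaticNumber (Dseq ch k) χ × c < χ)
    × ((k : ℕ) → 1 ≤ k → IsBackedgeCliqueNumber (Dseq ch k) 2)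
corollary4p6 ch = unbounded , backedgeCliqueNumber
  where
  unbounded : (c : ℕ) → Σ ℕ λ k → 1 ≤ k × Σ ℕ λ χ → IsDichromaticNumber (Dseq ch k) χ × c < χ
  unbounded c =
    let χ , isχ = dichromaticNumber (Dseq ch (suc c))
    in suc c , s≤s z≤n , χ , isχ , <⇒≤ (Dseq-needs-colours ch c (proj₁ isχ))
  backedgeCliqueNumber : (k : ℕ) → 1 ≤ k → IsBackedgeCliqueNumber (Dseq ch k) 2
  backedgeCliqueNumber (suc k) _ =
    backedgeCliqueNumber≡2 (Dseq-triangle ch k) (Dseq-backTriangleFree ch k)
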